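{- Let $m\ge 1$, $L\ge 0$ and $H\ge 0$ be integers, and let $$\Omega_H=\Big\{x=(x_1,\dots,x_m)\in\mathbb{R}^m:\ x_1\ge x_2\ge\dots\ge x_m\ge 0,\ x_1+\dots+x_m=L,\ 2\sum_{k=1}^m (k-1)x_k\ge (m-1)L-H\Big\}.$$ Then the number $M_H$ of points of $\mathbb{Z}^m$ lying in $\Omega_H$ satisfies $M_H\le (H+1)^m$. -}

module Defs where

open import Data.Nat using (ℕ; zero; suc)
open import Data.Integer using (ℤ; +_; _+_; _*_; _-_; _≤_)
open import Data.Fin using (Fin)
import Data.Fin as Fin
open import Data.Vec using (Vec; []; _∷_; lookup)
open import Data.Product using (_×_)
open import Relation.Binary.PropositionalEquality using (_≡_)

isum : ∀ {m} → Vec ℤ m → ℤ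
isum []       = + 0
isum (x ∷ xs) = x + isum xs

-- weightedFrom k (x₁,…,xₘ) = Σ_{i=1}^m (k + i - 1) xᵢ ; the paper's Σ (k-1) x_k is weightedFrom 0
weightedFrom : ∀ {m} → ℕ → Vec ℤ m → ℤ
weightedFrom k []       = + 0
weightedFrom k (x ∷ xs) = (+ k) * x + weightedFrom (suc k) xs

InΩ : (m L H : ℕ) → Vec ℤ m → Set
InΩ m L H x =
    (∀ (i j : Fin m) → i Fin.≤ j → lookup x j ≤ lookup x i)
  × (∀ (i : Fin m) → + 0 ≤ lookup x i)
  × (isum x ≡ + L)
  × ((+ (m Data.Nat.∸ 1)) * (+ L) - (+ H) ≤ (+ 2) * weightedFrom 0 x)

{-# OPTIONS --safe #-}
module Submission where

-- The quantity (m−1)L − 2Σ(k−1)xₖ equals the sum of pairwise gaps Σ_{i<j}(xᵢ − xⱼ), so for a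
-- nonincreasing x ∈ Ω_H it bounds x₁ − xₘ, whence every offset xᵢ − xₘ lies in {0,…,H}.
-- The offsets determine x, since Σxᵢ = L fixes xₘ; so x ↦ (xᵢ − xₘ)ᵢ injects the lattice
-- points of Ω_H into {0,…,H}^m.

open import Level using (Level)
open import Function using (_∘_)
open import Data.Nat as ℕ using (ℕ; suc; z≤n; s≤s)
import Data.Nat.Properties as ℕ
open import Data.Fin as Fin using (Fin; fromℕ; fromℕ<; funToFin; finToFun)
import Data.Fin.Properties as Fin
open import Data.Vec using (Vec; []; _∷_; lookup; tabulate)
open import Data.Vec.Properties using (tabulate∘lookup; tabulate-cong)
open import Data.Vec.Relation.Unary.All as VecAll using ([]; _∷_)
open import Data.Vec.Relation.Unary.All.Properties using (lookup⁻)
open import Data.Vec.Relation.Unary.AllPairs using (AllPairs; []; _∷_)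
open import Data.List as List using (List; length)
open import Data.List.Relation.Unary.All as All using (All)
open import Data.List.Relation.Unary.AllPairs using (_∷_)
open import Data.List.Relation.Unary.Unique.Propositional using (Unique)
open import Data.List.Membership.Propositional.Properties using (∈-lookup)
open import Data.Product using (_×_; _,_)
open import Relation.Unary using (Pred)
open import Relation.Binary.PropositionalEquality
open import Relation.Nullary using (¬_)
open import Data.Integer using (ℤ)
open import Defs

private
  variable
    a p : Level
    A : Set a

funToFin-injective : ∀ {m n} {f g : Fin m → Fin n} → funToFin f ≡ funToFin g → ∀ i → f i ≡ g i
funToFin-injective {f = f} {g} eq i = begin
  f i                        ≡⟨ Fin.finToFun-funToFin f i ⟨
  finToFun (funToFin f) i    ≡⟨ cong (λ c → finToFun c i) eq ⟩
  finToFun (funToFin g) i    ≡⟨ Fin.finToFun-funToFin g i ⟩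
  g i                        ∎
  where open ≡-Reasoning

Unique⇒lookup-injective : ∀ {xs : List A} → Unique xs →
                          ∀ {i j} → i Fin.< j → List.lookup xs i ≢ List.lookup xs j
Unique⇒lookup-injective (x∉xs ∷ _) {Fin.zero} {Fin.suc j} _ = All.lookup x∉xs (∈-lookup j)
Unique⇒lookup-injective (_ ∷ u) {Fin.suc i} {Fin.suc j} (s≤s i<j) =
  Unique⇒lookup-injective u i<j

length≤-by-injectiveCode : ∀ {P : Pred A p} {n} (code : ∀ x → P x → Fin n) →
                           (∀ {x y} (px : P x) (py : P y) → code x px ≡ code y py → x ≡ y) →
                           ∀ {xs} → Unique xs → All P xs → length xs ℕ.≤ n
length≤-by-injectiveCode {P = P} {n} code code-injective {xs} unique pxs = ℕ.≮⇒≥ n≮length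
  where
  pxs[_] : ∀ i → P (List.lookup xs i)
  pxs[ i ] = All.lookup pxs (∈-lookup i)

  n≮length : ¬ (n ℕ.< length xs)
  n≮length n<length =
    let i , j , i<j , codes≡ = Fin.pigeonhole n<length (λ i → code (List.lookup xs i) pxs[ i ])
    in Unique⇒lookup-injective unique i<j (code-injective pxs[ i ] pxs[ j ] codes≡)

-- Scoped so that ℤ's _+_ and _≤_ do not clash with the ℕ operators in the statement of lemma3.
module _ where
  open import Data.Integer using (+_; -_; _+_; _-_; _*_; _≤_; _≥_; ∣_∣)
  import Data.Integer.Properties as ℤ
  open import Data.Integer.Tactic.RingSolver using (solve-∀)

  weightedFrom-suc : ∀ {m} k (x : Vec ℤ m) → weightedFrom (suc k) x ≡ weightedFrom k x + isum x
  weightedFrom-suc k []       = refl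
  weightedFrom-suc k (a ∷ xs) =
    trans (cong (_+_ (+ suc k * a)) (weightedFrom-suc (suc k) xs))
          (shift (+ k) a (weightedFrom (suc k) xs) (isum xs))
    where
    shift : ∀ k a w s → (+ 1 + k) * a + (w + s) ≡ (k * a + w) + (a + s)
    shift = solve-∀

  All≤u⇒isum≤m*u : ∀ {m} {u} {x : Vec ℤ m} → VecAll.All (_≤ u) x → isum x ≤ + m * u
  All≤u⇒isum≤m*u {u = u} [] = ℤ.≤-reflexive (sym (ℤ.*-zeroˡ u))
  All≤u⇒isum≤m*u {suc m} {u} {a ∷ x} (a≤u ∷ x≤u) = begin
    a + isum x           ≤⟨ ℤ.+-mono-≤ a≤u (All≤u⇒isum≤m*u x≤u) ⟩
    u + + m * u          ≡⟨ sym (ℤ.suc-* (+ m) u) ⟩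
    + suc m * u          ∎
    where open ℤ.≤-Reasoning

  pairwiseGapSum : ∀ {m} → Vec ℤ m → ℤ
  pairwiseGapSum []             = + 0
  pairwiseGapSum {suc m} (a ∷ x) = (+ m * a - isum x) + pairwiseGapSum x

  pairwiseGapSum-closedForm : ∀ {m} (x : Vec ℤ (suc m)) →
                              pairwiseGapSum x ≡ + m * isum x - + 2 * weightedFrom 0 x
  pairwiseGapSum-closedForm (a ∷ []) = single a
    where
    single : ∀ a → (+ 0 * a - + 0) + + 0 ≡ + 0 * (a + + 0) - + 2 * (+ 0 * a + + 0)
    single = solve-∀
  pairwiseGapSum-closedForm {suc m} (a ∷ x) = begin
    (+ suc m * a - isum x) + pairwiseGapSum x
      ≡⟨ cong (_+_ (+ suc m * a - isum x)) (pairwiseGapSum-closedForm x) ⟩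
    (+ suc m * a - isum x) + (+ m * isum x - + 2 * weightedFrom 0 x)
      ≡⟨ regroup (+ m) a (isum x) (weightedFrom 0 x) ⟩
    + suc m * (a + isum x) - + 2 * (+ 0 * a + (weightedFrom 0 x + isum x))
      ≡⟨ cong (λ w → + suc m * (a + isum x) - + 2 * (+ 0 * a + w)) (sym (weightedFrom-suc 0 x)) ⟩
    + suc m * (a + isum x) - + 2 * weightedFrom 0 (a ∷ x)
      ∎
    where
    open ≡-Reasoning
    regroup : ∀ m a s w → ((+ 1 + m) * a - s) + (m * s - + 2 * w)
                        ≡ (+ 1 + m) * (a + s) - + 2 * (+ 0 * a + (w + s))
    regroup = solve-∀

  spread≤pairwiseGapSum : ∀ {m} {x : Vec ℤ (suc m)} → AllPairs _≥_ x →
                          lookup x Fin.zero - lookup x (fromℕ m) ≤ pairwiseGapSum x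
  spread≤pairwiseGapSum {x = a ∷ []} _ = ℤ.≤-reflexive (ℤ.+-inverseʳ a)
  spread≤pairwiseGapSum {suc m} {a ∷ b ∷ x} (a≥b∷x ∷ b∷x-antitone) = begin
    a - ℓ                                                  ≡⟨ ℤ.+-minus-telescope a b ℓ ⟨
    (a - b) + (b - ℓ)                                      ≤⟨ ℤ.+-mono-≤ firstGap (spread≤pairwiseGapSum b∷x-antitone) ⟩
    (+ suc m * a - isum (b ∷ x)) + pairwiseGapSum (b ∷ x)  ∎
    where
    open ℤ.≤-Reasoning
    ℓ : ℤ
    ℓ = lookup (b ∷ x) (fromℕ m)
    regroup : ∀ m a b s → (a - b) + (m * a - s) ≡ (+ 1 + m) * a - (b + s)
    regroup = solve-∀
    firstGap : a - b ≤ + suc m * a - isum (b ∷ x)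
    firstGap = begin
      a - b                           ≡⟨ ℤ.+-identityʳ (a - b) ⟨
      (a - b) + + 0                   ≤⟨ ℤ.+-monoʳ-≤ (a - b) (ℤ.i≤j⇒0≤j-i (All≤u⇒isum≤m*u (VecAll.tail a≥b∷x))) ⟩
      (a - b) + (+ m * a - isum x)    ≡⟨ regroup (+ m) a b (isum x) ⟩
      + suc m * a - isum (b ∷ x)      ∎

  antitone⇒AllPairs : ∀ {m} {x : Vec ℤ m} →
                      (∀ i j → i Fin.≤ j → lookup x j ≤ lookup x i) → AllPairs _≥_ x
  antitone⇒AllPairs {x = []}    _        = []
  antitone⇒AllPairs {x = _ ∷ _} antitone =
    lookup⁻ (λ j → antitone Fin.zero (Fin.suc j) z≤n) ∷
    antitone⇒AllPairs (λ i j i≤j → antitone (Fin.suc i) (Fin.suc j) (s≤s i≤j))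

  i-j≤k⇒i-k≤j : ∀ {i j k} → i - j ≤ k → i - k ≤ j
  i-j≤k⇒i-k≤j {i} {j} {k} i-j≤k = begin
    i - k                 ≡⟨ ℤ.+-minus-telescope i j k ⟨
    (i - j) + (j - k)     ≤⟨ ℤ.+-monoˡ-≤ (j - k) i-j≤k ⟩
    k + (j - k)           ≡⟨ unshuffle j k ⟩
    j                     ∎
    where
    open ℤ.≤-Reasoning
    unshuffle : ∀ j k → k + (j - k) ≡ j
    unshuffle = solve-∀

  isum-translate : ∀ {m} (x y : Vec ℤ m) {a b} → (∀ i → lookup x i - a ≡ lookup y i - b) →
                   isum x - + m * a ≡ isum y - + m * b
  isum-translate []      []      _  = refl
  isum-translate {suc m} (u ∷ x) (v ∷ y) {a} {b} eq = begin
    (u + isum x) - + suc m * a      ≡⟨ split u (isum x) (+ m) a ⟩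
    (u - a) + (isum x - + m * a)    ≡⟨ cong₂ _+_ (eq Fin.zero) (isum-translate x y (eq ∘ Fin.suc)) ⟩
    (v - b) + (isum y - + m * b)    ≡⟨ split v (isum y) (+ m) b ⟨
    (v + isum y) - + suc m * b      ∎
    where
    open ≡-Reasoning
    split : ∀ u s m a → (u + s) - (+ 1 + m) * a ≡ (u - a) + (s - m * a)
    split = solve-∀

  offsets≡∧isum≡⇒≡ : ∀ {m} {x y : Vec ℤ (suc m)} {a b} →
                        (∀ i → lookup x i - a ≡ lookup y i - b) → isum x ≡ isum y → x ≡ y
  offsets≡∧isum≡⇒≡ {m} {x} {y} {a} {b} eq sums≡ = begin
    x                      ≡⟨ tabulate∘lookup x ⟨
    tabulate (lookup x)    ≡⟨ tabulate-cong x≗y ⟩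
    tabulate (lookup y)    ≡⟨ tabulate∘lookup y ⟩
    y                      ∎
    where
    open ≡-Reasoning
    undo : ∀ s t → s - (s - t) ≡ t
    undo = solve-∀
    m*a≡m*b : + suc m * a ≡ + suc m * b
    m*a≡m*b = begin
      + suc m * a                      ≡⟨ undo (isum x) (+ suc m * a) ⟨
      isum x - (isum x - + suc m * a)  ≡⟨ cong₂ _-_ sums≡ (isum-translate x y eq) ⟩
      isum y - (isum y - + suc m * b)  ≡⟨ undo (isum y) (+ suc m * b) ⟩
      + suc m * b                      ∎
    a≡b : a ≡ b
    a≡b = ℤ.*-cancelˡ-≡ (+ suc m) a b m*a≡m*b
    addBack : ∀ u a → u ≡ (u - a) + a
    addBack = solve-∀
    x≗y : ∀ i → lookup x i ≡ lookup y i
    x≗y i = begin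
      lookup x i              ≡⟨ addBack (lookup x i) a ⟩
      (lookup x i - a) + a    ≡⟨ cong₂ _+_ (eq i) a≡b ⟩
      (lookup y i - b) + b    ≡⟨ addBack (lookup y i) b ⟨
      lookup y i              ∎

  fromℤ≤ : ∀ {z H} → + 0 ≤ z → z ≤ + H → Fin (suc H)
  fromℤ≤ {z} {H} 0≤z z≤H =
    fromℕ< (s≤s (ℤ.drop‿+≤+ (subst (_≤ + H) (sym (ℤ.0≤i⇒+∣i∣≡i 0≤z)) z≤H)))

  fromℤ≤-injective : ∀ {z w H} (0≤z : + 0 ≤ z) (z≤H : z ≤ + H) (0≤w : + 0 ≤ w) (w≤H : w ≤ + H) →
                     fromℤ≤ 0≤z z≤H ≡ fromℤ≤ 0≤w w≤H → z ≡ w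
  fromℤ≤-injective {z} {w} 0≤z _ 0≤w _ eq = begin
    z            ≡⟨ ℤ.0≤i⇒+∣i∣≡i 0≤z ⟨
    + ∣ z ∣      ≡⟨ cong +_ (Fin.fromℕ<-injective ∣ z ∣ ∣ w ∣ _ _ eq) ⟩
    + ∣ w ∣      ≡⟨ ℤ.0≤i⇒+∣i∣≡i 0≤w ⟩
    w            ∎
    where open ≡-Reasoning

  InΩ⇒spread≤H : ∀ {n L H} (x : Vec ℤ (suc n)) → InΩ (suc n) L H x →
                 lookup x Fin.zero - lookup x (fromℕ n) ≤ + H
  InΩ⇒spread≤H {n} {L} {H} x (antitone , _ , sum≡L , weighted) = begin
    lookup x Fin.zero - lookup x (fromℕ n)  ≤⟨ spread≤pairwiseGapSum (antitone⇒AllPairs {x = x} antitone) ⟩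
    pairwiseGapSum x                        ≡⟨ pairwiseGapSum-closedForm x ⟩
    + n * isum x - + 2 * weightedFrom 0 x   ≡⟨ cong (λ s → + n * s - + 2 * weightedFrom 0 x) sum≡L ⟩
    + n * + L - + 2 * weightedFrom 0 x      ≤⟨ i-j≤k⇒i-k≤j {+ n * + L} weighted ⟩
    + H                                     ∎
    where open ℤ.≤-Reasoning

  InΩ⇒offsets-in-range : ∀ {n L H} (x : Vec ℤ (suc n)) → InΩ (suc n) L H x →
                         ∀ i → + 0 ≤ lookup x i - lookup x (fromℕ n) × lookup x i - lookup x (fromℕ n) ≤ + H
  InΩ⇒offsets-in-range {n} x x∈Ω@(antitone , _) i =
    ℤ.i≤j⇒0≤j-i (antitone i (fromℕ n) (Fin.≤fromℕ i)) ,
    ℤ.≤-trans (ℤ.+-monoˡ-≤ (- lookup x (fromℕ n)) (antitone Fin.zero i z≤n)) (InΩ⇒spread≤H x x∈Ω)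

  Ωoffsets : ∀ {n L H} (x : Vec ℤ (suc n)) → InΩ (suc n) L H x → Fin (suc n) → Fin (suc H)
  Ωoffsets x x∈Ω i = let 0≤xᵢ-ℓ , xᵢ-ℓ≤H = InΩ⇒offsets-in-range x x∈Ω i in fromℤ≤ 0≤xᵢ-ℓ xᵢ-ℓ≤H

  Ωoffsets-injective : ∀ {n L H} {x y : Vec ℤ (suc n)} (x∈Ω : InΩ (suc n) L H x) (y∈Ω : InΩ (suc n) L H y) →
                       (∀ i → Ωoffsets x x∈Ω i ≡ Ωoffsets y y∈Ω i) → x ≡ y
  Ωoffsets-injective {n} {x = x} {y} x∈Ω@(_ , _ , sumx≡L , _) y∈Ω@(_ , _ , sumy≡L , _) offsets≗ =
    offsets≡∧isum≡⇒≡ {x = x} {y} differences≡ (trans sumx≡L (sym sumy≡L))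
    where
    differences≡ : ∀ i → lookup x i - lookup x (fromℕ n) ≡ lookup y i - lookup y (fromℕ n)
    differences≡ i =
      let 0≤xᵢ-ℓ , xᵢ-ℓ≤H = InΩ⇒offsets-in-range x x∈Ω i
          0≤yᵢ-ℓ , yᵢ-ℓ≤H = InΩ⇒offsets-in-range y y∈Ω i
      in fromℤ≤-injective 0≤xᵢ-ℓ xᵢ-ℓ≤H 0≤yᵢ-ℓ yᵢ-ℓ≤H (offsets≗ i)

open import Data.Nat using (_≤_; _+_; _^_)

lemma3 : (m L H : ℕ) → 1 ≤ m →
         (ps : List (Vec ℤ m)) → Unique ps → All (InΩ m L H) ps →
         length ps ≤ (H + 1) ^ m
lemma3 (suc n) L H _ ps unique ps⊆Ω =
  subst (λ k → length ps ≤ k ^ suc n) (ℕ.+-comm 1 H)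
        (length≤-by-injectiveCode (λ x x∈Ω → funToFin (Ωoffsets x x∈Ω))
                                  (λ x∈Ω y∈Ω → Ωoffsets-injective x∈Ω y∈Ω ∘ funToFin-injective)
                                  unique ps⊆Ω)
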